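{- Let $a_1,\dots,a_n$ be positive integers and $k\ge 2$, $M$ integers with $\sum_{i=1}^n a_i = kM$, $a_i<M$ and $M-a_i-2\ge 0$ for all $i$, and let $D$, $s$, $t$ and $\ell=(n+2k-2)M$ be as in the construction described in the context. If there are $2k$ paths $P_0, \dots, P_{2k-1}$ from $s$ to $t$ in $D$ such that $|P_i \triangle P_{i'}| \ge 2\ell - 2M$ for all $0 \le i < i' \le 2k-1$, then there is a partition of $\{1,\dots,n\}$ into $k$ sets $I_0,\dots,I_{k-1}$ with $\sum_{j\in I_q} a_j = M$ for every $q$.
   Context: Paths are identified with their arc sets; $\triangle$ is symmetric difference. Construction of the unweighted directed graph $D$: all gadgets below are vertex-disjoint except for the identifications stated. Let "a copy of $P$" mean a directed path with $M-2$ arcs. The block $H$ consists of $k$ copies of $P$ together with two new vertices $u,v$, an arc from $u$ to the first vertex of each copy and an arc from the last vertex of each copy to $v$. Take $2k-2$ copies $H_1,\dots,H_{2k-2}$ of $H$, with $u_j,v_j$ the vertices $u,v$ of $H_j$, and identify $v_j$ with $u_{j+1}$ for $1\le j\le 2k-3$; set $s=u_1$ and $r=v_{2k-2}$. For each $1\le i\le n$, build $H'_i$: vertices $p_i,q_i$; $2k-2$ copies of $P$, each with an arc from $p_i$ to its first vertex and an arc from its last vertex to $q_i$; a directed path $Q_i$ with $a_i-1$ arcs and two directed paths $Q'_i,Q''_i$ with $M-a_i-2$ arcs each; arcs from $p_i$ to the first vertex of $Q_i$, from the last vertex of $Q_i$ to the first vertex of $Q'_i$ and to the first vertex of $Q''_i$,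 and from the last vertices of $Q'_i$ and $Q''_i$ to $q_i$. Identify $q_i$ with $p_{i+1}$ for $1\le i\le n-1$, identify $r$ with $p_1$, and set $t=q_n$. Every $s$–$t$ path in $D$ has exactly $\ell=(n+2k-2)M$ arcs. -}

module Defs where

open import Data.Nat using (ℕ; zero; suc; _+_; _*_; _∸_; _≤_; _<_)
import Data.Nat as ℕ
open import Data.Fin using (Fin; toℕ)
import Data.Fin as F
open import Data.Bool using (if_then_else_)
open import Data.List using (List; []; _∷_; length; filter)
open import Data.List.Relation.Unary.Unique.Propositional using (Unique)
open import Data.Product using (_×_; _,_)
open import Data.Product.Properties using (≡-dec)
open import Relation.Binary.PropositionalEquality using (_≡_; refl; cong; cong₂)
open import Relation.Binary.Definitions using (DecidableEquality)
open import Relation.Nullary using (yes; no; ¬?)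
open import Relation.Nullary.Decidable using (⌊_⌋)
import Data.List.Membership.DecPropositional as DecMem

-- Gadget indices i are 0-based (i : Fin n stands for the paper's i+1),
-- block indices j are 0-based, copy indices c are 0-based, and positions
-- x along a directed path are 0-based.
--   junc j   : the chain of identified vertices
--              junc 0 = s = u_1, junc j = v_j = u_{j+1} (1 ≤ j ≤ 2k-3),
--              junc (2k-2) = r = v_{2k-2} = p_1,
--              junc (2k-2+i) = p_{i+1} = q_i,  junc (2k-2+n) = q_n = t.
--   hp j c x : x-th vertex of the c-th copy of P in block H_{j+1}
--   gp i c x : x-th vertex of the c-th copy of P in H'_{i+1}
--   qv i x   : x-th vertex of Q_{i+1}
--   q1 i x   : x-th vertex of Q'_{i+1}
--   q2 i x   : x-th vertex of Q''_{i+1}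

data V (n : ℕ) : Set where
  junc : ℕ → V n
  hp   : ℕ → ℕ → ℕ → V n
  gp   : Fin n → ℕ → ℕ → V n
  qv   : Fin n → ℕ → V n
  q1   : Fin n → ℕ → V n
  q2   : Fin n → ℕ → V n

pIdx : (k : ℕ) → ℕ → ℕ
pIdx k i = (2 * k ∸ 2) + i

-- Arcs of D.  A copy of P (M-2 arcs) has vertices at positions 0 .. M-2;
-- Q_i (a_i - 1 arcs) has positions 0 .. a_i - 1;
-- Q'_i, Q''_i (M - a_i - 2 arcs) have positions 0 .. M - a_i - 2.
data Arc (n k M : ℕ) (a : Fin n → ℕ) : V n → V n → Set where
  h-in   : ∀ {j c} → j < 2 * k ∸ 2 → c < k → 1 < M →
           Arc n k M a (junc j) (hp j c 0)
  h-step : ∀ {j c x} → j < 2 * k ∸ 2 → c < k → suc (suc x) < M →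
           Arc n k M a (hp j c x) (hp j c (suc x))
  h-out  : ∀ {j c x} → j < 2 * k ∸ 2 → c < k → x + 2 ≡ M →
           Arc n k M a (hp j c x) (junc (suc j))
  g-in   : ∀ {i c} → c < 2 * k ∸ 2 → 1 < M →
           Arc n k M a (junc (pIdx k (toℕ i))) (gp i c 0)
  g-step : ∀ {i c x} → c < 2 * k ∸ 2 → suc (suc x) < M →
           Arc n k M a (gp i c x) (gp i c (suc x))
  g-out  : ∀ {i c x} → c < 2 * k ∸ 2 → x + 2 ≡ M →
           Arc n k M a (gp i c x) (junc (suc (pIdx k (toℕ i))))
  q-in   : ∀ {i} → 0 < a i →
           Arc n k M a (junc (pIdx k (toℕ i))) (qv i 0)
  q-step : ∀ {i x} → suc x < a i →
           Arc n k M a (qv i x) (qv i (suc x))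
  q-q1   : ∀ {i x} → suc x ≡ a i → a i + 2 ≤ M →
           Arc n k M a (qv i x) (q1 i 0)
  q-q2   : ∀ {i x} → suc x ≡ a i → a i + 2 ≤ M →
           Arc n k M a (qv i x) (q2 i 0)
  q1-step : ∀ {i x} → x + a i + 3 ≤ M →
           Arc n k M a (q1 i x) (q1 i (suc x))
  q2-step : ∀ {i x} → x + a i + 3 ≤ M →
           Arc n k M a (q2 i x) (q2 i (suc x))
  q1-out : ∀ {i x} → x + a i + 2 ≡ M →
           Arc n k M a (q1 i x) (junc (suc (pIdx k (toℕ i))))
  q2-out : ∀ {i x} → x + a i + 2 ≡ M →
           Arc n k M a (q2 i x) (junc (suc (pIdx k (toℕ i))))

sV : ∀ {n} → V n
sV = junc 0

tV : ∀ {n} → (k : ℕ) → V n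
tV {n} k = junc (pIdx k n)

data Walk (n k M : ℕ) (a : Fin n → ℕ) : V n → V n → Set where
  []  : ∀ {v} → Walk n k M a v v
  _∷_ : ∀ {u w v} → Arc n k M a u w → Walk n k M a w v → Walk n k M a u v

vertices : ∀ {n k M a u v} → Walk n k M a u v → List (V n)
vertices {u = u} []       = u ∷ []
vertices {u = u} (_ ∷ w)  = u ∷ vertices w

arcs : ∀ {n k M a u v} → Walk n k M a u v → List (V n × V n)
arcs [] = []
arcs {u = u} (_∷_ {w = w} _ p) = (u , w) ∷ arcs p

record STPath (n k M : ℕ) (a : Fin n → ℕ) : Set where
  constructor mkPath
  field
    walk     : Walk n k M a sV (tV k)
    distinct : Unique (vertices walk)
open STPath public

_≟V_ : ∀ {n} → DecidableEquality (V n)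
junc x ≟V junc y with x ℕ.≟ y
... | yes refl = yes refl
... | no ne = no λ { refl → ne refl }
hp x y z ≟V hp x' y' z' with x ℕ.≟ x' | y ℕ.≟ y' | z ℕ.≟ z'
... | yes refl | yes refl | yes refl = yes refl
... | no ne | _ | _ = no λ { refl → ne refl }
... | _ | no ne | _ = no λ { refl → ne refl }
... | _ | _ | no ne = no λ { refl → ne refl }
gp x y z ≟V gp x' y' z' with x F.≟ x' | y ℕ.≟ y' | z ℕ.≟ z'
... | yes refl | yes refl | yes refl = yes refl
... | no ne | _ | _ = no λ { refl → ne refl }
... | _ | no ne | _ = no λ { refl → ne refl }
... | _ | _ | no ne = no λ { refl → ne refl }
qv x y ≟V qv x' y' with x F.≟ x' | y ℕ.≟ y'
... | yes refl | yes refl = yes refl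
... | no ne | _ = no λ { refl → ne refl }
... | _ | no ne = no λ { refl → ne refl }
q1 x y ≟V q1 x' y' with x F.≟ x' | y ℕ.≟ y'
... | yes refl | yes refl = yes refl
... | no ne | _ = no λ { refl → ne refl }
... | _ | no ne = no λ { refl → ne refl }
q2 x y ≟V q2 x' y' with x F.≟ x' | y ℕ.≟ y'
... | yes refl | yes refl = yes refl
... | no ne | _ = no λ { refl → ne refl }
... | _ | no ne = no λ { refl → ne refl }
junc _ ≟V hp _ _ _ = no λ ()
junc _ ≟V gp _ _ _ = no λ ()
junc _ ≟V qv _ _ = no λ ()
junc _ ≟V q1 _ _ = no λ ()
junc _ ≟V q2 _ _ = no λ ()
hp _ _ _ ≟V junc _ = no λ ()
hp _ _ _ ≟V gp _ _ _ = no λ ()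
hp _ _ _ ≟V qv _ _ = no λ ()
hp _ _ _ ≟V q1 _ _ = no λ ()
hp _ _ _ ≟V q2 _ _ = no λ ()
gp _ _ _ ≟V junc _ = no λ ()
gp _ _ _ ≟V hp _ _ _ = no λ ()
gp _ _ _ ≟V qv _ _ = no λ ()
gp _ _ _ ≟V q1 _ _ = no λ ()
gp _ _ _ ≟V q2 _ _ = no λ ()
qv _ _ ≟V junc _ = no λ ()
qv _ _ ≟V hp _ _ _ = no λ ()
qv _ _ ≟V gp _ _ _ = no λ ()
qv _ _ ≟V q1 _ _ = no λ ()
qv _ _ ≟V q2 _ _ = no λ ()
q1 _ _ ≟V junc _ = no λ ()
q1 _ _ ≟V hp _ _ _ = no λ ()
q1 _ _ ≟V gp _ _ _ = no λ ()
q1 _ _ ≟V qv _ _ = no λ ()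
q1 _ _ ≟V q2 _ _ = no λ ()
q2 _ _ ≟V junc _ = no λ ()
q2 _ _ ≟V hp _ _ _ = no λ ()
q2 _ _ ≟V gp _ _ _ = no λ ()
q2 _ _ ≟V qv _ _ = no λ ()
q2 _ _ ≟V q1 _ _ = no λ ()

_≟A_ : ∀ {n} → DecidableEquality (V n × V n)
_≟A_ = ≡-dec _≟V_ _≟V_

-- |A △ B| = |A ∖ B| + |B ∖ A|   (arc lists of paths have no duplicates)
symDiffSize : ∀ {n} → List (V n × V n) → List (V n × V n) → ℕ
symDiffSize {n} A B =
  length (filter (λ e → ¬? (e ∈? B)) A) + length (filter (λ e → ¬? (e ∈? A)) B)
  where open DecMem (_≟A_ {n})

sumFin : ∀ {n} → (Fin n → ℕ) → ℕ
sumFin {zero}  f = 0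
sumFin {suc n} f = f F.zero + sumFin (λ i → f (F.suc i))

ℓ : (n k M : ℕ) → ℕ
ℓ n k M = (n + 2 * k ∸ 2) * M

partSum : ∀ {n k} → (Fin n → ℕ) → (Fin n → Fin k) → Fin k → ℕ
partSum a f q = sumFin (λ j → if ⌊ f j F.≟ q ⌋ then a j else 0)

{-# OPTIONS --safe #-}
module Submission where

-- Every s–t path runs through the 2k−2 blocks H_j and then the n gadgets H'_i, spending exactly
-- M arcs in each, so it has ℓ arcs, and the hypothesis says that any two of the 2k paths share
-- at most M arcs. Two paths through the same copy of P in a block share its M arcs; two paths
-- whose routes through H'_i have the same key (the same copy of P, or Q_i followed by either
-- branch) share at least a_i arcs. Among the (2k−2)k + k pairs of paths, every block is shared
-- by at least k pairs (there are k copies) and every gadget by at least one pair (there are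
-- 2k−1 keys); charge gadget i to such a pair. A pair sharing a block has no capacity left, so
-- the total charge ∑ a_i = kM must fit into the at most k pairs sharing no block, each of
-- capacity M. Hence there are exactly k such pairs, each charged exactly M: they index the parts.

open import Defs
open import Data.Bool using (Bool; true; false; if_then_else_)
open import Data.Empty using (⊥; ⊥-elim)
open import Data.Fin using (Fin; toℕ; fromℕ<)
import Data.Fin as F
open import Data.Fin.Properties using (toℕ<n; fromℕ<-toℕ; toℕ-fromℕ<; fromℕ<-cong; toℕ-injective)
open import Data.List using (List; []; _∷_; length; _++_; filter)
open import Data.List.Properties using (length-++; filter-++; filter-all; filter-accept)
open import Data.List.Membership.Propositional using (_∈_)
open import Data.List.Membership.Propositional.Properties using (∈-++⁺ˡ; ∈-++⁺ʳ)
open import Data.List.Relation.Binary.Subset.Propositional using (_⊆_)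
import Data.List.Relation.Unary.All as All
open import Data.List.Relation.Unary.Any using (here; there)
open import Data.Nat
open import Data.Nat.Properties
open import Data.Nat.DivMod
open import Data.Nat.Tactic.RingSolver using (solve-∀)
open import Data.Product using (Σ; _×_; _,_; proj₁; proj₂)
open import Data.Sum using (inj₁; inj₂)
open import Data.Unit using (⊤; tt)
open import Function using (_∘_)
open import Relation.Binary.Definitions using (tri<; tri≈; tri>)
open import Relation.Binary.PropositionalEquality
open import Relation.Nullary using (Dec; yes; no; ¬_; ¬?)
open import Relation.Nullary.Decidable using (⌊_⌋)

∑ : ℕ → (ℕ → ℕ) → ℕ
∑ zero    f = 0
∑ (suc m) f = ∑ m f + f m

syntax ∑ m (λ x → e) = ∑[ x < m ] e

∑-cong : ∀ m {f g} → (∀ x → x < m → f x ≡ g x) → ∑ m f ≡ ∑ m g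
∑-cong zero    _ = refl
∑-cong (suc m) e = cong₂ _+_ (∑-cong m (λ x x<m → e x (m<n⇒m<1+n x<m))) (e m ≤-refl)

∑-mono-≤ : ∀ m {f g} → (∀ x → x < m → f x ≤ g x) → ∑ m f ≤ ∑ m g
∑-mono-≤ zero    _ = z≤n
∑-mono-≤ (suc m) h = +-mono-≤ (∑-mono-≤ m (λ x x<m → h x (m<n⇒m<1+n x<m))) (h m ≤-refl)

∑-zero : ∀ m {f} → (∀ x → x < m → f x ≡ 0) → ∑ m f ≡ 0
∑-zero zero    _ = refl
∑-zero (suc m) e = cong₂ _+_ (∑-zero m (λ x x<m → e x (m<n⇒m<1+n x<m))) (e m ≤-refl)

∑-distrib-+ : ∀ m f g → ∑[ x < m ] (f x + g x) ≡ ∑ m f + ∑ m g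
∑-distrib-+ zero    f g = refl
∑-distrib-+ (suc m) f g =
  trans (cong (_+ (f m + g m)) (∑-distrib-+ m f g)) (interchange (∑ m f) (∑ m g) (f m) (g m))
  where
    interchange : ∀ a b c d → (a + b) + (c + d) ≡ (a + c) + (b + d)
    interchange = solve-∀

∑-distribˡ-* : ∀ m c f → ∑[ x < m ] (c * f x) ≡ c * ∑ m f
∑-distribˡ-* zero    c f = sym (*-zeroʳ c)
∑-distribˡ-* (suc m) c f = trans (cong (_+ c * f m) (∑-distribˡ-* m c f)) (sym (*-distribˡ-+ c (∑ m f) (f m)))

∑-distribʳ-* : ∀ m c f → ∑[ x < m ] (f x * c) ≡ ∑ m f * c
∑-distribʳ-* m c f = trans (∑-cong m (λ x _ → *-comm (f x) c)) (trans (∑-distribˡ-* m c f) (*-comm c (∑ m f)))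

∑-const : ∀ m c → ∑[ _ < m ] c ≡ m * c
∑-const zero    c = refl
∑-const (suc m) c = trans (cong (_+ c) (∑-const m c)) (+-comm (m * c) c)

∑-split : ∀ m n f → ∑ (m + n) f ≡ ∑ m f + ∑[ x < n ] f (m + x)
∑-split m zero    f = trans (cong (λ l → ∑ l f) (+-identityʳ m)) (sym (+-identityʳ _))
∑-split m (suc n) f = trans (cong (λ l → ∑ l f) (+-suc m n))
  (trans (cong (_+ f (m + n)) (∑-split m n f)) (+-assoc (∑ m f) _ _))

∑-suc : ∀ m f → ∑ (suc m) f ≡ f 0 + ∑[ x < m ] f (suc x)
∑-suc zero    f = +-comm 0 (f 0)
∑-suc (suc m) f = trans (cong (_+ f (suc m)) (∑-suc m f)) (+-assoc (f 0) _ _)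

∑-comm : ∀ m n (F : ℕ → ℕ → ℕ) → ∑[ x < m ] ∑[ y < n ] F x y ≡ ∑[ y < n ] ∑[ x < m ] F x y
∑-comm zero    n F = sym (∑-zero n (λ _ _ → refl))
∑-comm (suc m) n F = trans (cong (_+ ∑ n (F m)) (∑-comm m n F))
  (sym (∑-distrib-+ n (λ y → ∑[ x < m ] F x y) (F m)))

∑-flatten : ∀ m n f → ∑ (m * n) f ≡ ∑[ q < m ] ∑[ p < n ] f (q * n + p)
∑-flatten zero    n f = refl
∑-flatten (suc m) n f = trans (cong (λ l → ∑ l f) (+-comm n (m * n)))
  (trans (∑-split (m * n) n f) (cong (_+ ∑[ p < n ] f (m * n + p)) (∑-flatten m n f)))

term≤∑ : ∀ m f {x} → x < m → f x ≤ ∑ m f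
term≤∑ (suc m) f {x} x<1+m with m<1+n⇒m<n∨m≡n x<1+m
... | inj₁ x<m  = ≤-trans (term≤∑ m f x<m) (m≤m+n _ _)
... | inj₂ refl = m≤n+m _ _

∑-prefix-≤ : ∀ {m m'} f → m ≤ m' → ∑ m f ≤ ∑ m' f
∑-prefix-≤ {m} {m'} f m≤m' = subst (λ l → ∑ m f ≤ ∑ l f) (m+[n∸m]≡n m≤m')
  (subst (∑ m f ≤_) (sym (∑-split m (m' ∸ m) f)) (m≤m+n _ _))

0<∑⇒∃0< : ∀ m f → 0 < ∑ m f → Σ ℕ λ x → x < m × 0 < f x
0<∑⇒∃0< (suc m) f 0<∑ with f m in eq
... | suc _ = m , ≤-refl , subst (0 <_) (sym eq) (s≤s z≤n)
... | zero with 0<∑⇒∃0< m f (subst (0 <_) (+-identityʳ (∑ m f)) 0<∑)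
...   | x , x<m , 0<fx = x , m<n⇒m<1+n x<m , 0<fx

pointwise≤∧∑≥⇒≡ : ∀ m f g → (∀ x → x < m → f x ≤ g x) → ∑ m g ≤ ∑ m f →
                  ∀ x → x < m → f x ≡ g x
pointwise≤∧∑≥⇒≡ (suc m) f g f≤g ∑g≤∑f x x<1+m with m<1+n⇒m<n∨m≡n x<1+m
... | inj₁ x<m  = pointwise≤∧∑≥⇒≡ m f g f≤g′ ∑g≤∑f′ x x<m
  where
    f≤g′ : ∀ x → x < m → f x ≤ g x
    f≤g′ x x<m = f≤g x (m<n⇒m<1+n x<m)
    ∑g≤∑f′ : ∑ m g ≤ ∑ m f
    ∑g≤∑f′ = +-cancelʳ-≤ (g m) _ _ (≤-trans ∑g≤∑f (+-monoʳ-≤ (∑ m f) (f≤g m ≤-refl)))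
... | inj₂ refl = ≤-antisym (f≤g m ≤-refl)
  (+-cancelˡ-≤ (∑ m g) _ _
    (≤-trans ∑g≤∑f (+-monoˡ-≤ (f m) (∑-mono-≤ m (λ x x<m → f≤g x (m<n⇒m<1+n x<m))))))

gauss : ∀ m → 2 * ∑[ q < m ] q + m ≡ m * m
gauss zero    = refl
gauss (suc m) = trans (regroup (∑[ q < m ] q) m) (trans (cong (_+ suc (m + m)) (gauss m)) (square m))
  where
    regroup : ∀ s m → 2 * (s + m) + suc m ≡ (2 * s + m) + suc (m + m)
    regroup = solve-∀
    square : ∀ m → m * m + suc (m + m) ≡ suc m * suc m
    square = solve-∀

sumFin≡∑ : ∀ {n} (g : Fin n → ℕ) (G : ℕ → ℕ) → (∀ j → g j ≡ G (toℕ j)) → sumFin g ≡ ∑ n G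
sumFin≡∑ {zero}  g G _ = refl
sumFin≡∑ {suc n} g G e =
  trans (cong₂ _+_ (e F.zero) (sumFin≡∑ (g ∘ F.suc) (G ∘ suc) (e ∘ F.suc))) (sym (∑-suc n G))

𝟙 : ∀ {A : Set} → Dec A → ℕ
𝟙 (yes _) = 1
𝟙 (no _)  = 0

𝟙-yes : ∀ {A : Set} (d : Dec A) → A → 𝟙 d ≡ 1
𝟙-yes (yes _) _ = refl
𝟙-yes (no ¬a) a = ⊥-elim (¬a a)

𝟙-no : ∀ {A : Set} (d : Dec A) → ¬ A → 𝟙 d ≡ 0
𝟙-no (yes a) ¬a = ⊥-elim (¬a a)
𝟙-no (no _)  _  = refl

𝟙≤1 : ∀ {A : Set} (d : Dec A) → 𝟙 d ≤ 1
𝟙≤1 (yes _) = ≤-refl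
𝟙≤1 (no _)  = z≤n

𝟙-mono : ∀ {A B : Set} (d : Dec A) (e : Dec B) → (A → B) → 𝟙 d ≤ 𝟙 e
𝟙-mono (yes a) e f = ≤-reflexive (sym (𝟙-yes e (f a)))
𝟙-mono (no _)  _ _ = z≤n

𝟙-cong : ∀ {A B : Set} (d : Dec A) (e : Dec B) → (A → B) → (B → A) → 𝟙 d ≡ 𝟙 e
𝟙-cong d e f g = ≤-antisym (𝟙-mono d e f) (𝟙-mono e d g)

𝟙-if : ∀ {A : Set} (d : Dec A) x → (if ⌊ d ⌋ then x else 0) ≡ 𝟙 d * x
𝟙-if (yes _) x = sym (+-identityʳ x)
𝟙-if (no _)  x = refl

δ : ℕ → ℕ → ℕ
δ x y = 𝟙 (x ≟ y)

δ-refl : ∀ x → δ x x ≡ 1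
δ-refl x = 𝟙-yes (x ≟ x) refl

δ-≢ : ∀ {x y} → x ≢ y → δ x y ≡ 0
δ-≢ {x} {y} = 𝟙-no (x ≟ y)

δ-sym : ∀ x y → δ x y ≡ δ y x
δ-sym x y = 𝟙-cong (x ≟ y) (y ≟ x) sym sym

∑-δ : ∀ m v c → v < m → ∑[ x < m ] (δ v x * c) ≡ c
∑-δ (suc m) v c v<1+m with m<1+n⇒m<n∨m≡n v<1+m
... | inj₁ v<m  = trans (cong (∑[ x < m ] (δ v x * c) +_) (cong (_* c) (δ-≢ (<⇒≢ v<m))))
                        (trans (+-identityʳ _) (∑-δ m v c v<m))
... | inj₂ refl = trans (cong₂ _+_ (∑-zero v (λ x x<v → cong (_* c) (δ-≢ (>⇒≢ x<v))))
                                   (cong (_* c) (δ-refl v)))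
                        (+-identityʳ c)

∑-restrict : ∀ N q X → q ≤ N → ∑[ p < N ] (𝟙 (p <? q) * X p) ≡ ∑ q X
∑-restrict N q X q≤N = begin
  ∑[ p < N ] (𝟙 (p <? q) * X p)
    ≡⟨ cong (λ l → ∑[ p < l ] (𝟙 (p <? q) * X p)) (sym (m+[n∸m]≡n q≤N)) ⟩
  ∑[ p < q + (N ∸ q) ] (𝟙 (p <? q) * X p)
    ≡⟨ ∑-split q (N ∸ q) _ ⟩
  ∑[ p < q ] (𝟙 (p <? q) * X p) + ∑[ x < N ∸ q ] (𝟙 (q + x <? q) * X (q + x))
    ≡⟨ cong₂ _+_ (∑-cong q (λ p p<q → trans (cong (_* X p) (𝟙-yes (p <? q) p<q)) (*-identityˡ (X p))))
                 (∑-zero (N ∸ q) (λ x _ → cong (_* X (q + x)) (𝟙-no (q + x <? q) (m+n≮m q x)))) ⟩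
  ∑ q X + 0
    ≡⟨ +-identityʳ _ ⟩
  ∑ q X ∎
  where open ≡-Reasoning

-- For 0/1-valued z, ∑ t z is the rank of t among the points where z is 1.
rank-strictMono : ∀ z {t t'} → z t ≡ 1 → t < t' → ∑ t z < ∑ t' z
rank-strictMono z {t} zt≡1 t<t' = <-≤-trans (m<m+n (∑ t z) (subst (0 <_) (sym zt≡1) (s≤s z≤n)))
                                            (∑-prefix-≤ z t<t')

rank-injective : ∀ z {t t'} → z t ≡ 1 → z t' ≡ 1 → ∑ t z ≡ ∑ t' z → t ≡ t'
rank-injective z {t} {t'} zt≡1 zt'≡1 eq with <-cmp t t'
... | tri< t<t' _ _ = ⊥-elim (<-irrefl eq (rank-strictMono z zt≡1 t<t'))
... | tri≈ _ t≡t' _ = t≡t'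
... | tri> _ _ t>t' = ⊥-elim (<-irrefl (sym eq) (rank-strictMono z zt'≡1 t>t'))

rank-surjective : ∀ m z → (∀ x → z x ≤ 1) → ∀ q → q < ∑ m z →
                  Σ ℕ λ t → t < m × z t ≡ 1 × ∑ t z ≡ q
rank-surjective (suc m) z z≤1 q q<∑ with q <? ∑ m z
... | yes q<∑′ with rank-surjective m z z≤1 q q<∑′
...   | t , t<m , zt≡1 , rank≡q = t , m<n⇒m<1+n t<m , zt≡1 , rank≡q
rank-surjective (suc m) z z≤1 q q<∑ | no q≮∑′ with n≤1⇒n≡0∨n≡1 (z≤1 m)
... | inj₁ zm≡0 = ⊥-elim (q≮∑′ (subst (q <_) (trans (cong (∑ m z +_) zm≡0) (+-identityʳ (∑ m z))) q<∑))
... | inj₂ zm≡1 = m , ≤-refl , zm≡1 , ≤-antisym (≮⇒≥ q≮∑′)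
                      (≤-pred (subst (q <_) (trans (cong (∑ m z +_) zm≡1) (+-comm (∑ m z) 1)) q<∑))

collisions : (ℕ → ℕ) → ℕ → ℕ
collisions v m = ∑[ q < m ] ∑[ p < q ] δ (v p) (v q)

module _ (v : ℕ → ℕ) (B : ℕ) where
  private
    multiplicity : ℕ → ℕ → ℕ
    multiplicity c m = ∑[ p < m ] δ (v p) c

    occupied : ℕ → ℕ
    occupied m = ∑[ c < B ] 𝟙 (0 <? multiplicity c m)

    occupied≤B : ∀ m → occupied m ≤ B
    occupied≤B m = ≤-trans (∑-mono-≤ B (λ c _ → 𝟙≤1 (0 <? multiplicity c m)))
                           (≤-reflexive (trans (∑-const B 1) (*-identityʳ B)))

    occupied-mono : ∀ m → occupied m ≤ occupied (suc m)
    occupied-mono m = ∑-mono-≤ B (λ c _ → 𝟙-mono (0 <? multiplicity c m) (0 <? multiplicity c (suc m))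
                                                 (λ 0<mult → <-≤-trans 0<mult (m≤m+n _ _)))

    newColour : ∀ m c → multiplicity (v m) m ≡ 0 →
                𝟙 (0 <? multiplicity c m) + δ (v m) c * 1 ≤ 𝟙 (0 <? multiplicity c (suc m))
    newColour m c unused with v m ≟ c
    ... | yes refl rewrite unused = ≤-refl
    ... | no _     rewrite +-identityʳ (𝟙 (0 <? multiplicity c m)) | +-identityʳ (multiplicity c m) = ≤-refl

    occupied-step : ∀ m → v m < B → occupied m + 1 ≤ multiplicity (v m) m + occupied (suc m)
    occupied-step m vm<B with multiplicity (v m) m in eq
    ... | suc y = subst (occupied m + 1 ≤_) (+-comm (occupied (suc m)) (suc y))
                        (+-mono-≤ (occupied-mono m) (s≤s z≤n))
    ... | zero  = begin
      occupied m + 1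
        ≡⟨ cong (occupied m +_) (sym (∑-δ B (v m) 1 vm<B)) ⟩
      occupied m + ∑[ c < B ] (δ (v m) c * 1)
        ≡⟨ sym (∑-distrib-+ B _ _) ⟩
      ∑[ c < B ] (𝟙 (0 <? multiplicity c m) + δ (v m) c * 1)
        ≤⟨ ∑-mono-≤ B (λ c _ → newColour m c eq) ⟩
      occupied (suc m) ∎
      where open ≤-Reasoning

    collisions+occupied : ∀ m → (∀ p → p < m → v p < B) → m ≤ collisions v m + occupied m
    collisions+occupied zero    _   = z≤n
    collisions+occupied (suc m) v<B = begin
      suc m
        ≡⟨ +-comm 1 m ⟩
      m + 1
        ≤⟨ +-monoˡ-≤ 1 (collisions+occupied m (λ p p<m → v<B p (m<n⇒m<1+n p<m))) ⟩
      collisions v m + occupied m + 1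
        ≡⟨ +-assoc (collisions v m) (occupied m) 1 ⟩
      collisions v m + (occupied m + 1)
        ≤⟨ +-monoʳ-≤ (collisions v m) (occupied-step m (v<B m ≤-refl)) ⟩
      collisions v m + (multiplicity (v m) m + occupied (suc m))
        ≡⟨ sym (+-assoc (collisions v m) _ _) ⟩
      collisions v (suc m) + occupied (suc m) ∎
      where open ≤-Reasoning

  pigeonhole : ∀ m → (∀ p → p < m → v p < B) → m ≤ collisions v m + B
  pigeonhole m v<B = ≤-trans (collisions+occupied m v<B) (+-monoʳ-≤ (collisions v m) (occupied≤B m))

-- t < N * N encodes the ordered pair (lower t , upper t); isPair keeps those with lower t < upper t.
module Pairs (N : ℕ) .{{_ : NonZero N}} where

  lower upper : ℕ → ℕ
  lower t = t % N
  upper t = t / N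

  isPair : ℕ → ℕ
  isPair t = 𝟙 (lower t <? upper t)

  lower-encode : ∀ q p → p < N → lower (q * N + p) ≡ p
  lower-encode q p p<N = trans (cong (_% N) (+-comm (q * N) p))
                               (trans ([m+kn]%n≡m%n p q N) (m<n⇒m%n≡m p<N))

  upper-encode : ∀ q p → p < N → upper (q * N + p) ≡ q
  upper-encode q p p<N = trans (cong (_/ N) (+-comm (q * N) p))
    (trans (+-distrib-/ p (q * N) p%N+qN%N<N) (cong₂ _+_ (m<n⇒m/n≡0 p<N) (m*n/n≡m q N)))
    where
      p%N+qN%N<N : p % N + (q * N) % N < N
      p%N+qN%N<N = subst (_< N) (sym (trans (cong₂ _+_ (m<n⇒m%n≡m p<N) (m*n%n≡0 q N)) (+-identityʳ p))) p<N

  ∑-pairs : (F : ℕ → ℕ → ℕ) →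
            ∑[ t < N * N ] (isPair t * F (lower t) (upper t)) ≡ ∑[ q < N ] ∑[ p < q ] F p q
  ∑-pairs F = trans (∑-flatten N N (λ t → isPair t * F (lower t) (upper t))) (∑-cong N (λ q q<N →
    trans (∑-cong N (λ p p<N → cong₂ (λ l u → 𝟙 (l <? u) * F l u)
                                     (lower-encode q p p<N) (upper-encode q p p<N)))
          (∑-restrict N q (λ p → F p q) (<⇒≤ q<N))))

  #pairs : 2 * ∑[ t < N * N ] isPair t + N ≡ N * N
  #pairs = trans (cong (λ s → 2 * s + N) count) (gauss N)
    where
      count : ∑[ t < N * N ] isPair t ≡ ∑[ q < N ] q
      count = trans (∑-cong (N * N) (λ t _ → sym (*-identityʳ (isPair t))))
                (trans (∑-pairs (λ _ _ → 1)) (∑-cong N (λ q _ → trans (∑-const q 1) (*-identityʳ q))))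

-- Row p < 2k stands for a path: blockChoice p j is the copy of P it uses in block j, and
-- gadgetChoice p i the key of its route through gadget i.
module EqualPartition
  (k K n M : ℕ) .{{_ : NonZero M}} (K+2≡2k : K + 2 ≡ 2 * k)
  (a : ℕ → ℕ) (a-pos : ∀ i → i < n → 0 < a i) (∑a≡kM : ∑ n a ≡ k * M)
  (blockChoice gadgetChoice : ℕ → ℕ → ℕ)
  (blockChoice<k : ∀ p j → p < 2 * k → j < K → blockChoice p j < k)
  (gadgetChoice≤K : ∀ p i → p < 2 * k → i < n → gadgetChoice p i < suc K)
  (agreement≤M : ∀ p q → p < q → q < 2 * k →
     M * ∑[ j < K ] δ (blockChoice p j) (blockChoice q j)
       + ∑[ i < n ] (δ (gadgetChoice p i) (gadgetChoice q i) * a i) ≤ M)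
  where

  N : ℕ
  N = 2 * k

  instance
    N-nonZero : NonZero N
    N-nonZero = >-nonZero (subst (0 <_) K+2≡2k (<-≤-trans (s≤s z≤n) (m≤n+m 2 K)))

  open Pairs N

  T : ℕ
  T = N * N

  blockAgreements : ℕ → ℕ
  blockAgreements t = isPair t * ∑[ j < K ] δ (blockChoice (lower t) j) (blockChoice (upper t) j)

  gadgetAgrees : ℕ → ℕ → ℕ
  gadgetAgrees i t = isPair t * δ (gadgetChoice (lower t) i) (gadgetChoice (upper t) i)

  gadgetWeight : ℕ → ℕ
  gadgetWeight t = ∑[ i < n ] (gadgetAgrees i t * a i)

  overlapWeight : ℕ → ℕ
  overlapWeight t = M * blockAgreements t + gadgetWeight t

  overlapWeight≤ : ∀ t → t < T → overlapWeight t ≤ M * isPair t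
  overlapWeight≤ t t<T = bound (lower t <? upper t)
    where
      B = ∑[ j < K ] δ (blockChoice (lower t) j) (blockChoice (upper t) j)
      G = λ i → δ (gadgetChoice (lower t) i) (gadgetChoice (upper t) i)
      bound : (d : Dec (lower t < upper t)) → M * (𝟙 d * B) + ∑[ i < n ] (𝟙 d * G i * a i) ≤ M * 𝟙 d
      bound (yes l<u) = subst₂ _≤_
        (cong₂ (λ b g → M * b + g) (sym (*-identityˡ B))
               (∑-cong n (λ i _ → cong (_* a i) (sym (*-identityˡ (G i))))))
        (sym (*-identityʳ M))
        (agreement≤M (lower t) (upper t) l<u (m<n*o⇒m/o<n t<T))
      bound (no _) =
        ≤-trans (≤-reflexive (trans (cong (_+ ∑[ i < n ] 0) (*-zeroʳ M)) (∑-zero n (λ _ _ → refl)))) z≤n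

  ∑isPair : ∑ T isPair ≡ K * k + k
  ∑isPair = *-cancelˡ-≡ _ _ 2 (+-cancelʳ-≡ N _ _ (trans #pairs (sym count)))
    where
      count : 2 * (K * k + k) + N ≡ N * N
      count = trans (expand K k) (cong (_* N) K+2≡2k)
        where
          expand : ∀ K k → 2 * (K * k + k) + 2 * k ≡ (K + 2) * (2 * k)
          expand = solve-∀

  ∑blockAgreements≥ : K * k ≤ ∑ T blockAgreements
  ∑blockAgreements≥ = subst₂ _≤_ (∑-const K k) (sym swap) (∑-mono-≤ K perBlock)
    where
      agreesIn : ℕ → ℕ → ℕ
      agreesIn j t = isPair t * δ (blockChoice (lower t) j) (blockChoice (upper t) j)
      swap : ∑ T blockAgreements ≡ ∑[ j < K ] ∑[ t < T ] agreesIn j t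
      swap = trans (∑-cong T (λ t _ → sym (∑-distribˡ-* K (isPair t) _))) (∑-comm T K (λ t j → agreesIn j t))
      perBlock : ∀ j → j < K → k ≤ ∑[ t < T ] agreesIn j t
      perBlock j j<K = subst (k ≤_) (sym (∑-pairs (λ p q → δ (blockChoice p j) (blockChoice q j))))
        (+-cancelʳ-≤ k k _ (subst (_≤ collisions (λ p → blockChoice p j) N + k) (cong (k +_) (+-identityʳ k))
          (pigeonhole (λ p → blockChoice p j) k N (λ p p<N → blockChoice<k p j p<N j<K))))

  ∑gadgetAgrees≥1 : ∀ i → i < n → 1 ≤ ∑ T (gadgetAgrees i)
  ∑gadgetAgrees≥1 i i<n = subst (1 ≤_) (sym (∑-pairs (λ p q → δ (gadgetChoice p i) (gadgetChoice q i))))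
    (+-cancelʳ-≤ (suc K) 1 _ (subst (_≤ collisions (λ p → gadgetChoice p i) N + suc K)
                                    (trans (sym K+2≡2k) (+-comm K 2))
      (pigeonhole (λ p → gadgetChoice p i) (suc K) N (λ p p<N → gadgetChoice≤K p i p<N i<n))))

  witness : ℕ → ℕ
  witness i with i <? n
  ... | yes i<n = proj₁ (0<∑⇒∃0< T (gadgetAgrees i) (∑gadgetAgrees≥1 i i<n))
  ... | no _    = 0

  witness-spec : ∀ i → i < n → witness i < T × 0 < gadgetAgrees i (witness i)
  witness-spec i i<n with i <? n
  ... | yes i<n′ = proj₂ (0<∑⇒∃0< T (gadgetAgrees i) (∑gadgetAgrees≥1 i i<n′))
  ... | no i≮n   = ⊥-elim (i≮n i<n)

  load : ℕ → ℕ
  load t = ∑[ i < n ] (δ (witness i) t * a i)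

  load≤gadgetWeight : ∀ t → load t ≤ gadgetWeight t
  load≤gadgetWeight t = ∑-mono-≤ n (λ i i<n → *-monoˡ-≤ (a i) (δ≤agrees i i<n (witness i ≟ t)))
    where
      δ≤agrees : ∀ i → i < n → Dec (witness i ≡ t) → δ (witness i) t ≤ gadgetAgrees i t
      δ≤agrees i i<n (yes refl) = subst (_≤ gadgetAgrees i (witness i)) (sym (δ-refl (witness i)))
                                        (proj₂ (witness-spec i i<n))
      δ≤agrees i i<n (no w≢t)   = subst (_≤ gadgetAgrees i t) (sym (δ-≢ w≢t)) z≤n

  ∑load : ∑ T load ≡ k * M
  ∑load = trans (∑-comm T n (λ t i → δ (witness i) t * a i))
                (trans (∑-cong n (λ i i<n → ∑-δ T (witness i) (a i) (proj₁ (witness-spec i i<n)))) ∑a≡kM)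

  ∑blockAgreements≤ : ∑ T blockAgreements ≤ K * k
  ∑blockAgreements≤ = *-cancelˡ-≤ M (+-cancelʳ-≤ (k * M) _ _ (begin
    M * ∑ T blockAgreements + k * M
      ≡⟨ cong (M * ∑ T blockAgreements +_) (sym ∑load) ⟩
    M * ∑ T blockAgreements + ∑ T load
      ≤⟨ +-monoʳ-≤ (M * ∑ T blockAgreements) (∑-mono-≤ T (λ t _ → load≤gadgetWeight t)) ⟩
    M * ∑ T blockAgreements + ∑ T gadgetWeight
      ≡⟨ cong (_+ ∑ T gadgetWeight) (sym (∑-distribˡ-* T M blockAgreements)) ⟩
    ∑[ t < T ] (M * blockAgreements t) + ∑ T gadgetWeight
      ≡⟨ sym (∑-distrib-+ T _ gadgetWeight) ⟩
    ∑ T overlapWeight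
      ≤⟨ ∑-mono-≤ T overlapWeight≤ ⟩
    ∑[ t < T ] (M * isPair t)
      ≡⟨ ∑-distribˡ-* T M isPair ⟩
    M * ∑ T isPair
      ≡⟨ cong (M *_) ∑isPair ⟩
    M * (K * k + k)
      ≡⟨ expand M K k ⟩
    M * (K * k) + k * M ∎))
    where
      open ≤-Reasoning
      expand : ∀ M K k → M * (K * k + k) ≡ M * (K * k) + k * M
      expand = solve-∀

  blockAgreements≤isPair : ∀ t → t < T → blockAgreements t ≤ isPair t
  blockAgreements≤isPair t t<T =
    *-cancelˡ-≤ M (≤-trans (m≤m+n (M * blockAgreements t) (gadgetWeight t)) (overlapWeight≤ t t<T))

  free : ℕ → ℕ
  free t = isPair t ∸ blockAgreements t

  free≤1 : ∀ t → free t ≤ 1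
  free≤1 t = ≤-trans (m∸n≤m (isPair t) (blockAgreements t)) (𝟙≤1 (lower t <? upper t))

  ∑free : ∑ T free ≡ k
  ∑free = +-cancelʳ-≡ (K * k) _ _ (begin
    ∑ T free + K * k
      ≡⟨ cong (∑ T free +_) (sym (≤-antisym ∑blockAgreements≤ ∑blockAgreements≥)) ⟩
    ∑ T free + ∑ T blockAgreements
      ≡⟨ sym (∑-distrib-+ T free blockAgreements) ⟩
    ∑[ t < T ] (free t + blockAgreements t)
      ≡⟨ ∑-cong T (λ t t<T → m∸n+n≡m (blockAgreements≤isPair t t<T)) ⟩
    ∑ T isPair
      ≡⟨ trans ∑isPair (+-comm (K * k) k) ⟩
    k + K * k ∎)
    where open ≡-Reasoning

  load≤M*free : ∀ t → t < T → load t ≤ M * free t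
  load≤M*free t t<T = subst (load t ≤_) (sym (*-distribˡ-∸ M (isPair t) (blockAgreements t)))
    (m+n≤o⇒m≤o∸n (load t) (≤-trans (subst (_≤ overlapWeight t) (+-comm (M * blockAgreements t) (load t))
                                            (+-monoʳ-≤ (M * blockAgreements t) (load≤gadgetWeight t)))
                                    (overlapWeight≤ t t<T)))

  load≡M*free : ∀ t → t < T → load t ≡ M * free t
  load≡M*free = pointwise≤∧∑≥⇒≡ T load (λ t → M * free t) load≤M*free
    (≤-reflexive (trans (∑-distribˡ-* T M free) (trans (cong (M *_) ∑free) (trans (*-comm M k) (sym ∑load)))))

  free-witness : ∀ i → i < n → free (witness i) ≡ 1
  free-witness i i<n with n≤1⇒n≡0∨n≡1 (free≤1 (witness i))
  ... | inj₂ free≡1 = free≡1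
  ... | inj₁ free≡0 = ⊥-elim (<-irrefl (sym load≡0) 0<load)
    where
      0<load : 0 < load (witness i)
      0<load = <-≤-trans (subst (0 <_) (sym (trans (cong (_* a i) (δ-refl (witness i))) (*-identityˡ (a i))))
                                (a-pos i i<n))
                         (term≤∑ n (λ i′ → δ (witness i′) (witness i) * a i′) i<n)
      load≡0 : load (witness i) ≡ 0
      load≡0 = trans (load≡M*free (witness i) (proj₁ (witness-spec i i<n)))
                     (trans (cong (M *_) free≡0) (*-zeroʳ M))

  class : ℕ → ℕ
  class i = ∑ (witness i) free

  class<k : ∀ i → i < n → class i < k
  class<k i i<n = subst (class i <_) ∑free (rank-strictMono free (free-witness i i<n) (proj₁ (witness-spec i i<n)))

  ∑class≡M : ∀ q → q < k → ∑[ i < n ] (δ (class i) q * a i) ≡ M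
  ∑class≡M q q<k with rank-surjective T free free≤1 q (subst (q <_) (sym ∑free) q<k)
  ... | t , t<T , free-t≡1 , rank≡q = begin
    ∑[ i < n ] (δ (class i) q * a i) ≡⟨ ∑-cong n (λ i i<n → cong (_* a i) (sameClass i i<n)) ⟩
    load t                           ≡⟨ load≡M*free t t<T ⟩
    M * free t                       ≡⟨ cong (M *_) free-t≡1 ⟩
    M * 1                            ≡⟨ *-identityʳ M ⟩
    M                                ∎
    where
      open ≡-Reasoning
      sameClass : ∀ i → i < n → δ (class i) q ≡ δ (witness i) t
      sameClass i i<n = 𝟙-cong (class i ≟ q) (witness i ≟ t)
        (λ class≡q → rank-injective free (free-witness i i<n) free-t≡1 (trans class≡q (sym rank≡q)))
        (λ { refl → rank≡q })

  equalPartition : Σ (ℕ → ℕ) λ f →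
    (∀ i → i < n → f i < k) × (∀ q → q < k → ∑[ i < n ] (δ (f i) q * a i) ≡ M)
  equalPartition = class , class<k , ∑class≡M

data Choice : Set where
  viaP : ℕ → Choice
  viaQ : Bool → Choice

copyIndex : Choice → ℕ
copyIndex (viaP c) = c
copyIndex (viaQ _) = 0

-- Routes through a gadget with the same key share at least a_i arcs: the same copy of P, or
-- the prefix through Q_i whichever branch follows it.
key : Choice → ℕ
key (viaP c) = suc c
key (viaQ _) = 0

choiceAt : List Choice → ℕ → Choice
choiceAt []       _       = viaP 0
choiceAt (x ∷ _)  zero    = x
choiceAt (_ ∷ xs) (suc m) = choiceAt xs m

extend : ∀ {A : Set} {n} → A → (Fin n → A) → ℕ → A
extend {n = n} d f m with m <? n
... | yes m<n = f (fromℕ< m<n)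
... | no _    = d

extend-fromℕ< : ∀ {A : Set} {n m} (d : A) (f : Fin n → A) (m<n : m < n) → extend d f m ≡ f (fromℕ< m<n)
extend-fromℕ< {n = n} {m} d f m<n with m <? n
... | yes m<n′ = cong f (fromℕ<-cong m m refl m<n′ m<n)
... | no m≮n   = ⊥-elim (m≮n m<n)

extend-toℕ : ∀ {A : Set} {n} (d : A) (f : Fin n → A) (i : Fin n) → extend d f (toℕ i) ≡ f i
extend-toℕ d f i = trans (extend-fromℕ< d f (toℕ<n i)) (cong f (fromℕ<-toℕ i (toℕ<n i)))

private
  stepPastEnd : ∀ {u w M} → u + 0 ≡ M → w ≡ suc u → w ≤ M → ⊥
  stepPastEnd {u} u+0≡M refl = <-irrefl (trans (sym (+-identityʳ u)) u+0≡M)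

  exitBeforeEnd : ∀ {u d M} → u + suc d ≡ M → u ≡ M → ⊥
  exitBeforeEnd {u} {d} u+1+d≡M u≡M
    with +-cancelˡ-≡ u (suc d) 0 (trans u+1+d≡M (trans (sym u≡M) (sym (+-identityʳ u))))
  ... | ()

  advance : ∀ x d → suc x + 2 + d ≡ x + 2 + suc d
  advance = solve-∀

  advanceQ : ∀ x A d → suc x + A + 2 + d ≡ x + A + 2 + suc d
  advanceQ = solve-∀

  +3≡suc+2 : ∀ x A → x + A + 3 ≡ suc (x + A + 2)
  +3≡suc+2 = solve-∀

  branchLength : ∀ {A M} → A + 2 ≤ M → 0 + A + 2 + (M ∸ A ∸ 2) ≡ M
  branchLength {A} {M} A+2≤M = trans (cong (A + 2 +_) (∸-+-assoc M A 2)) (m+[n∸m]≡n A+2≤M)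

-- For arc sets A, B of size l: d = |A ∖ B|, s = |A ∩ B|, d′ = |B ∖ A|, s′ = |B ∩ A|.
commonPart≤ : ∀ {l M c s s′ d d′} → d + s ≡ l → d′ + s′ ≡ l → c ≤ s → c ≤ s′ →
              2 * l ∸ 2 * M ≤ d + d′ → c ≤ M
commonPart≤ {l} {M} {c} {s} {s′} {d} {d′} d+s≡l d′+s′≡l c≤s c≤s′ far =
  *-cancelˡ-≤ 2 (+-cancelˡ-≤ (d + d′) _ _ (begin
    (d + d′) + 2 * c          ≤⟨ +-monoʳ-≤ (d + d′) (+-mono-≤ c≤s (+-monoˡ-≤ 0 c≤s′)) ⟩
    (d + d′) + (s + (s′ + 0)) ≡⟨ regroup d d′ s s′ ⟩
    (d + s) + ((d′ + s′) + 0) ≡⟨ cong₂ (λ x y → x + (y + 0)) d+s≡l d′+s′≡l ⟩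
    2 * l                     ≤⟨ m≤n+m∸n (2 * l) (2 * M) ⟩
    2 * M + (2 * l ∸ 2 * M)   ≤⟨ +-monoʳ-≤ (2 * M) far ⟩
    2 * M + (d + d′)          ≡⟨ +-comm (2 * M) (d + d′) ⟩
    (d + d′) + 2 * M          ∎))
  where
    open ≤-Reasoning
    regroup : ∀ d d′ s s′ → (d + d′) + (s + (s′ + 0)) ≡ (d + s) + ((d′ + s′) + 0)
    regroup = solve-∀

module Segments (n k M : ℕ) (a : Fin n → ℕ) where

  open import Data.List.Membership.DecPropositional (_≟A_ {n}) using (_∈?_)

  K : ℕ
  K = 2 * k ∸ 2

  Arcs : Set
  Arcs = List (V n × V n)

  entry exit : Fin n → V n
  entry i = junc (pIdx k (toℕ i))
  exit  i = junc (suc (pIdx k (toℕ i)))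

  -- A tail lists the arcs from position x of a directed path in a block or gadget to the end of
  -- that block or gadget; d counts the arcs left on the current path before it is exited.
  blockTail : ℕ → ℕ → ℕ → ℕ → Arcs
  blockTail j c x zero    = (hp j c x , junc (suc j)) ∷ []
  blockTail j c x (suc d) = (hp j c x , hp j c (suc x)) ∷ blockTail j c (suc x) d

  blockArcs : ℕ → ℕ → Arcs
  blockArcs j c = (junc j , hp j c 0) ∷ blockTail j c 0 (M ∸ 2)

  pTail : Fin n → ℕ → ℕ → ℕ → Arcs
  pTail i c x zero    = (gp i c x , exit i) ∷ []
  pTail i c x (suc d) = (gp i c x , gp i c (suc x)) ∷ pTail i c (suc x) d

  branch : Bool → Fin n → ℕ → V n
  branch true  = q1
  branch false = q2

  branchTail : Bool → Fin n → ℕ → ℕ → Arcs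
  branchTail b i x zero    = (branch b i x , exit i) ∷ []
  branchTail b i x (suc d) = (branch b i x , branch b i (suc x)) ∷ branchTail b i (suc x) d

  qTail : Fin n → ℕ → ℕ → Bool → Arcs
  qTail i x zero    b = (qv i x , branch b i 0) ∷ branchTail b i 0 (M ∸ a i ∸ 2)
  qTail i x (suc d) b = (qv i x , qv i (suc x)) ∷ qTail i (suc x) d b

  gadgetArcs : Fin n → Choice → Arcs
  gadgetArcs i (viaP c) = (entry i , gp i c 0) ∷ pTail i c 0 (M ∸ 2)
  gadgetArcs i (viaQ b) = (entry i , qv i 0) ∷ qTail i 0 (a i ∸ 1) b

  segmentArcs : ℕ → Choice → Arcs
  segmentArcs j ch with j <? K
  ... | yes _ = blockArcs j (copyIndex ch)
  ... | no _  = extend [] (λ i → gadgetArcs i ch) (j ∸ K)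

  routeArcs : ℕ → List Choice → Arcs
  routeArcs j []       = []
  routeArcs j (ch ∷ L) = segmentArcs j ch ++ routeArcs (suc j) L

  segmentArcs-block : ∀ {j} ch → j < K → segmentArcs j ch ≡ blockArcs j (copyIndex ch)
  segmentArcs-block {j} ch j<K with j <? K
  ... | yes _   = refl
  ... | no j≮K = ⊥-elim (j≮K j<K)

  segmentArcs-gadget : ∀ i ch → segmentArcs (K + toℕ i) ch ≡ gadgetArcs i ch
  segmentArcs-gadget i ch with K + toℕ i <? K
  ... | yes K+i<K = ⊥-elim (m+n≮m K (toℕ i) K+i<K)
  ... | no _ rewrite m+n∸m≡n K (toℕ i) = extend-toℕ [] (λ i → gadgetArcs i ch) i

  ValidChoice : ℕ → Choice → Set
  ValidChoice j ch = (j < K → copyIndex ch < k) × (K ≤ j → key ch < suc K)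

  ValidRoute : ℕ → List Choice → Set
  ValidRoute j []       = ⊤
  ValidRoute j (ch ∷ L) = ValidChoice j ch × ValidRoute (suc j) L

  choiceAt-valid : ∀ j L m → ValidRoute j L → m < length L → ValidChoice (j + m) (choiceAt L m)
  choiceAt-valid j (x ∷ L) zero    (v , _)  _         = subst (λ l → ValidChoice l x) (sym (+-identityʳ j)) v
  choiceAt-valid j (x ∷ L) (suc m) (_ , vs) (s≤s m<∣L∣) =
    subst (λ l → ValidChoice l (choiceAt L m)) (sym (+-suc j m)) (choiceAt-valid (suc j) L m vs m<∣L∣)

  record Decomposition (j T : ℕ) (as : Arcs) : Set where
    constructor decomposition
    field
      route        : List Choice
      route-length : j + length route ≡ T
      arcs≡        : as ≡ routeArcs j route
      valid        : ValidRoute j route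

  prepend : ∀ {j T} ch {as pre rest} → as ≡ pre ++ rest → segmentArcs j ch ≡ pre → ValidChoice j ch →
            Decomposition (suc j) T rest → Decomposition j T as
  prepend {j} ch refl refl v (decomposition L len eq val) =
    decomposition (ch ∷ L) (trans (+-suc j (length L)) len) (cong (segmentArcs j ch ++_) eq) (v , val)

  StartsWith : Arcs → ℕ → ℕ → Arcs → Set
  StartsWith tail j T as = Σ Arcs λ rest → (as ≡ tail ++ rest) × Decomposition j T rest

  gadgetChoiceValid : ∀ (i : Fin n) ch → key ch < suc K → ValidChoice (K + toℕ i) ch
  gadgetChoiceValid i ch key<1+K = (λ K+i<K → ⊥-elim (m+n≮m K (toℕ i) K+i<K)) , λ _ → key<1+K

  mutual
    decompose : ∀ {j T} (w : Walk n k M a (junc j) (junc T)) → Decomposition j T (arcs w)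
    decompose {j} [] = decomposition [] (+-identityʳ j) refl tt
    decompose {j} (h-in {c = c} j<K c<k 1<M ∷ w) with decomposeBlock (M ∸ 2) w (m+[n∸m]≡n 1<M)
    ... | rest , eq , r = prepend (viaP c) (cong (_ ∷_) eq) (segmentArcs-block (viaP c) j<K)
                                  ((λ _ → c<k) , (λ K≤j → ⊥-elim (<⇒≱ j<K K≤j))) r
    decompose (g-in {i} {c} c<K 1<M ∷ w) with decomposeP (M ∸ 2) w (m+[n∸m]≡n 1<M)
    ... | rest , eq , r = prepend (viaP c) (cong (_ ∷_) eq) (segmentArcs-gadget i (viaP c))
                                  (gadgetChoiceValid i (viaP c) (s≤s c<K)) r
    decompose (q-in {i} 0<a ∷ w) with decomposeQ (a i ∸ 1) w (m+[n∸m]≡n 0<a)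
    ... | b , rest , eq , r = prepend (viaQ b) (cong (_ ∷_) eq) (segmentArcs-gadget i (viaQ b))
                                      (gadgetChoiceValid i (viaQ b) (s≤s z≤n)) r

    decomposeBlock : ∀ {j c x T} d (w : Walk n k M a (hp j c x) (junc T)) → x + 2 + d ≡ M →
                     StartsWith (blockTail j c x d) (suc j) T (arcs w)
    decomposeBlock {x = x} zero (h-step _ _ x+2<M ∷ w) e = ⊥-elim (stepPastEnd e (cong suc (+-comm 2 x)) x+2<M)
    decomposeBlock {x = x} (suc d) (h-step _ _ _ ∷ w) e with decomposeBlock d w (trans (advance x d) e)
    ... | rest , eq , r = rest , cong (_ ∷_) eq , r
    decomposeBlock zero    (h-out _ _ _ ∷ w) _ = arcs w , refl , decompose w
    decomposeBlock (suc d) (h-out _ _ x+2≡M ∷ w) e = ⊥-elim (exitBeforeEnd e x+2≡M)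

    decomposeP : ∀ {i c x T} d (w : Walk n k M a (gp i c x) (junc T)) → x + 2 + d ≡ M →
                 StartsWith (pTail i c x d) (suc (pIdx k (toℕ i))) T (arcs w)
    decomposeP {x = x} zero (g-step _ x+2<M ∷ w) e = ⊥-elim (stepPastEnd e (cong suc (+-comm 2 x)) x+2<M)
    decomposeP {x = x} (suc d) (g-step _ _ ∷ w) e with decomposeP d w (trans (advance x d) e)
    ... | rest , eq , r = rest , cong (_ ∷_) eq , r
    decomposeP zero    (g-out _ _ ∷ w) _ = arcs w , refl , decompose w
    decomposeP (suc d) (g-out _ x+2≡M ∷ w) e = ⊥-elim (exitBeforeEnd e x+2≡M)

    decomposeQ : ∀ {i x T} d (w : Walk n k M a (qv i x) (junc T)) → suc x + d ≡ a i →
                 Σ Bool λ b → StartsWith (qTail i x d b) (suc (pIdx k (toℕ i))) T (arcs w)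
    decomposeQ zero (q-step x+1<a ∷ w) e = ⊥-elim (stepPastEnd e refl x+1<a)
    decomposeQ {x = x} (suc d) (q-step _ ∷ w) e with decomposeQ d w (trans (sym (+-suc (suc x) d)) e)
    ... | b , rest , eq , r = b , rest , cong (_ ∷_) eq , r
    decomposeQ {i} zero (q-q1 _ a+2≤M ∷ w) _ with decomposeQ′ (M ∸ a i ∸ 2) w (branchLength a+2≤M)
    ... | rest , eq , r = true , rest , cong (_ ∷_) eq , r
    decomposeQ {i} zero (q-q2 _ a+2≤M ∷ w) _ with decomposeQ″ (M ∸ a i ∸ 2) w (branchLength a+2≤M)
    ... | rest , eq , r = false , rest , cong (_ ∷_) eq , r
    decomposeQ (suc d) (q-q1 x+1≡a _ ∷ w) e = ⊥-elim (exitBeforeEnd e x+1≡a)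
    decomposeQ (suc d) (q-q2 x+1≡a _ ∷ w) e = ⊥-elim (exitBeforeEnd e x+1≡a)

    decomposeQ′ : ∀ {i x T} d (w : Walk n k M a (q1 i x) (junc T)) → x + a i + 2 + d ≡ M →
                  StartsWith (branchTail true i x d) (suc (pIdx k (toℕ i))) T (arcs w)
    decomposeQ′ {i} {x} zero (q1-step x+a+3≤M ∷ w) e = ⊥-elim (stepPastEnd e (+3≡suc+2 x (a i)) x+a+3≤M)
    decomposeQ′ {i} {x} (suc d) (q1-step _ ∷ w) e with decomposeQ′ d w (trans (advanceQ x (a i) d) e)
    ... | rest , eq , r = rest , cong (_ ∷_) eq , r
    decomposeQ′ zero    (q1-out _ ∷ w) _ = arcs w , refl , decompose w
    decomposeQ′ (suc d) (q1-out x+a+2≡M ∷ w) e = ⊥-elim (exitBeforeEnd e x+a+2≡M)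

    decomposeQ″ : ∀ {i x T} d (w : Walk n k M a (q2 i x) (junc T)) → x + a i + 2 + d ≡ M →
                  StartsWith (branchTail false i x d) (suc (pIdx k (toℕ i))) T (arcs w)
    decomposeQ″ {i} {x} zero (q2-step x+a+3≤M ∷ w) e = ⊥-elim (stepPastEnd e (+3≡suc+2 x (a i)) x+a+3≤M)
    decomposeQ″ {i} {x} (suc d) (q2-step _ ∷ w) e with decomposeQ″ d w (trans (advanceQ x (a i) d) e)
    ... | rest , eq , r = rest , cong (_ ∷_) eq , r
    decomposeQ″ zero    (q2-out _ ∷ w) _ = arcs w , refl , decompose w
    decomposeQ″ (suc d) (q2-out x+a+2≡M ∷ w) e = ⊥-elim (exitBeforeEnd e x+a+2≡M)

  blockTail-length : ∀ j c x d → length (blockTail j c x d) ≡ suc d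
  blockTail-length j c x zero    = refl
  blockTail-length j c x (suc d) = cong suc (blockTail-length j c (suc x) d)

  pTail-length : ∀ i c x d → length (pTail i c x d) ≡ suc d
  pTail-length i c x zero    = refl
  pTail-length i c x (suc d) = cong suc (pTail-length i c (suc x) d)

  branchTail-length : ∀ b i x d → length (branchTail b i x d) ≡ suc d
  branchTail-length b i x zero    = refl
  branchTail-length b i x (suc d) = cong suc (branchTail-length b i (suc x) d)

  qTail-length : ∀ i x d b → length (qTail i x d b) ≡ suc d + suc (M ∸ a i ∸ 2)
  qTail-length i x zero    b = cong suc (branchTail-length b i 0 (M ∸ a i ∸ 2))
  qTail-length i x (suc d) b = cong suc (qTail-length i (suc x) d b)

  aℕ : ℕ → ℕ
  aℕ = extend 0 a

  sharedBound : ℕ → Choice → Choice → ℕ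
  sharedBound j x y with j <? K
  ... | yes _ = δ (copyIndex x) (copyIndex y) * M
  ... | no _  = δ (key x) (key y) * aℕ (j ∸ K)

  sharedBound-block : ∀ {j} x y → j < K → sharedBound j x y ≡ δ (copyIndex x) (copyIndex y) * M
  sharedBound-block {j} x y j<K with j <? K
  ... | yes _   = refl
  ... | no j≮K = ⊥-elim (j≮K j<K)

  sharedBound-gadget : ∀ i x y → sharedBound (K + i) x y ≡ δ (key x) (key y) * aℕ i
  sharedBound-gadget i x y with K + i <? K
  ... | yes K+i<K = ⊥-elim (m+n≮m K i K+i<K)
  ... | no _      = cong (λ m → δ (key x) (key y) * aℕ m) (m+n∸m≡n K i)

  sharedBound-sym : ∀ j x y → sharedBound j x y ≡ sharedBound j y x
  sharedBound-sym j x y with j <? K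
  ... | yes _ = cong (_* M) (δ-sym (copyIndex x) (copyIndex y))
  ... | no _  = cong (_* aℕ (j ∸ K)) (δ-sym (key x) (key y))

  routeOverlap : List Choice → List Choice → ℕ
  routeOverlap L L′ = ∑[ m < K + n ] sharedBound m (choiceAt L m) (choiceAt L′ m)

  routeOverlap-sym : ∀ L L′ → routeOverlap L L′ ≡ routeOverlap L′ L
  routeOverlap-sym L L′ = ∑-cong (K + n) (λ m _ → sharedBound-sym m (choiceAt L m) (choiceAt L′ m))

  routeOverlap-split : ∀ L L′ → routeOverlap L L′ ≡
    M * ∑[ j < K ] δ (copyIndex (choiceAt L j)) (copyIndex (choiceAt L′ j))
      + ∑[ i < n ] (δ (key (choiceAt L (K + i))) (key (choiceAt L′ (K + i))) * aℕ i)
  routeOverlap-split L L′ = trans (∑-split K n _)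
    (cong₂ _+_ (trans (∑-cong K (λ j j<K → sharedBound-block _ _ j<K)) (trans (∑-distribʳ-* K M _) (*-comm _ M)))
               (∑-cong n (λ i _ → sharedBound-gadget i _ _)))

  countIn : Arcs → Arcs → ℕ
  countIn B X = length (filter (_∈? B) X)

  countIn-++ : ∀ B X Y → countIn B (X ++ Y) ≡ countIn B X + countIn B Y
  countIn-++ B X Y = trans (cong length (filter-++ (_∈? B) X Y)) (length-++ (filter (_∈? B) X))

  countIn-⊆ : ∀ {B X} → X ⊆ B → countIn B X ≡ length X
  countIn-⊆ {B} X⊆B = cong length (filter-all (_∈? B) (All.tabulate X⊆B))

  countIn-∷ : ∀ {B e} X → e ∈ B → countIn B (e ∷ X) ≡ suc (countIn B X)
  countIn-∷ {B} X e∈B = cong length (filter-accept (_∈? B) e∈B)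

  rejected+countIn : ∀ B X → length (filter (λ e → ¬? (e ∈? B)) X) + countIn B X ≡ length X
  rejected+countIn B []      = refl
  rejected+countIn B (e ∷ X) with e ∈? B
  ... | yes _ = trans (+-suc _ _) (cong suc (rejected+countIn B X))
  ... | no _  = cong suc (rejected+countIn B X)

  module Bounds (a-pos : ∀ i → 0 < a i) (a+2≤M : ∀ i → a i + 2 ≤ M) (2≤M : 2 ≤ M) where

    blockArcs-length : ∀ j c → length (blockArcs j c) ≡ M
    blockArcs-length j c = trans (cong suc (blockTail-length j c 0 (M ∸ 2))) (m+[n∸m]≡n 2≤M)

    gadgetArcs-length : ∀ i ch → length (gadgetArcs i ch) ≡ M
    gadgetArcs-length i (viaP c) = trans (cong suc (pTail-length i c 0 (M ∸ 2))) (m+[n∸m]≡n 2≤M)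
    gadgetArcs-length i (viaQ b) = trans (cong suc (qTail-length i 0 (a i ∸ 1) b))
      (total (a i ∸ 1) (M ∸ a i ∸ 2) (m+[n∸m]≡n (a-pos i)) (branchLength (a+2≤M i)))
      where
        total : ∀ {A M′} u v → suc u ≡ A → 0 + A + 2 + v ≡ M′ → suc (suc u + suc v) ≡ M′
        total u v refl refl = rearrange u v
          where
            rearrange : ∀ u v → suc (suc u + suc v) ≡ suc u + 2 + v
            rearrange = solve-∀

    segmentArcs-length : ∀ j ch → j < K + n → length (segmentArcs j ch) ≡ M
    segmentArcs-length j ch j<K+n with j <? K
    ... | yes _   = blockArcs-length j (copyIndex ch)
    ... | no j≮K = trans (cong length (extend-fromℕ< [] (λ i → gadgetArcs i ch) j∸K<n))
                         (gadgetArcs-length (fromℕ< j∸K<n) ch)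
      where
        j∸K<n : j ∸ K < n
        j∸K<n = +-cancelˡ-< K _ _ (subst (_< K + n) (sym (m+[n∸m]≡n (≮⇒≥ j≮K))) j<K+n)

    routeArcs-length : ∀ j L → j + length L ≤ K + n → length (routeArcs j L) ≡ length L * M
    routeArcs-length j []       _ = refl
    routeArcs-length j (ch ∷ L) j+1+|L|≤K+n = trans (length-++ (segmentArcs j ch))
      (cong₂ _+_ (segmentArcs-length j ch (<-≤-trans (m<m+n j z<s) j+1+|L|≤K+n))
                 (routeArcs-length (suc j) L (subst (_≤ K + n) (+-suc j (length L)) j+1+|L|≤K+n)))

    qTail-share : ∀ {B} i x d b b′ → qTail i x d b′ ⊆ B → d ≤ countIn B (qTail i x d b)
    qTail-share i x zero    b b′ _   = z≤n
    qTail-share i x (suc d) b b′ sub = subst (suc d ≤_) (sym (countIn-∷ (qTail i (suc x) d b) (sub (here refl))))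
                                             (s≤s (qTail-share i (suc x) d b b′ (λ e∈ → sub (there e∈))))

    sameKey-share : ∀ {B} i x y → key x ≡ key y → gadgetArcs i y ⊆ B → a i ≤ countIn B (gadgetArcs i x)
    sameKey-share i (viaP c) (viaP .c) refl sub =
      subst (a i ≤_) (sym (trans (countIn-⊆ sub) (gadgetArcs-length i (viaP c))))
            (≤-trans (m≤m+n (a i) 2) (a+2≤M i))
    sameKey-share i (viaQ b) (viaQ b′) refl sub =
      subst₂ _≤_ (m+[n∸m]≡n (a-pos i)) (sym (countIn-∷ (qTail i 0 (a i ∸ 1) b) (sub (here refl))))
             (s≤s (qTail-share i 0 (a i ∸ 1) b b′ (λ e∈ → sub (there e∈))))

    gadgetShare : ∀ {B} i x y → gadgetArcs i y ⊆ B → δ (key x) (key y) * a i ≤ countIn B (gadgetArcs i x)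
    gadgetShare {B} i x y sub with key x ≟ key y
    ... | yes same = subst (_≤ countIn B (gadgetArcs i x)) (sym (+-identityʳ (a i))) (sameKey-share i x y same sub)
    ... | no _     = z≤n

    blockShare : ∀ {B} j c c′ → blockArcs j c′ ⊆ B → δ c c′ * M ≤ countIn B (blockArcs j c)
    blockShare j c c′ sub with c ≟ c′
    ... | yes refl = ≤-reflexive (trans (+-identityʳ M) (sym (trans (countIn-⊆ sub) (blockArcs-length j c))))
    ... | no _     = z≤n

    segmentShare : ∀ {B} j x y → segmentArcs j y ⊆ B → sharedBound j x y ≤ countIn B (segmentArcs j x)
    segmentShare j x y sub with j <? K
    ... | yes _ = blockShare j (copyIndex x) (copyIndex y) sub
    ... | no _ with j ∸ K <? n
    ...   | yes j∸K<n = gadgetShare (fromℕ< j∸K<n) x y sub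
    ...   | no _      = ≤-trans (≤-reflexive (*-zeroʳ (δ (key x) (key y)))) z≤n

    routeShare : ∀ {B} j L L′ → length L ≡ length L′ → routeArcs j L′ ⊆ B →
                 ∑[ m < length L ] sharedBound (j + m) (choiceAt L m) (choiceAt L′ m) ≤ countIn B (routeArcs j L)
    routeShare j []      []       _  _ = z≤n
    routeShare j []      (_ ∷ _)  () _
    routeShare j (_ ∷ _) []       () _
    routeShare {B} j (x ∷ L) (y ∷ L′) eq sub = begin
      ∑[ m < suc (length L) ] sharedBound (j + m) (choiceAt (x ∷ L) m) (choiceAt (y ∷ L′) m)
        ≡⟨ ∑-suc (length L) _ ⟩
      sharedBound (j + 0) x y + ∑[ m < length L ] sharedBound (j + suc m) (choiceAt L m) (choiceAt L′ m)
        ≡⟨ cong₂ _+_ (cong (λ l → sharedBound l x y) (+-identityʳ j))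
                     (∑-cong (length L) (λ m _ →
                        cong (λ l → sharedBound l (choiceAt L m) (choiceAt L′ m)) (+-suc j m))) ⟩
      sharedBound j x y + ∑[ m < length L ] sharedBound (suc j + m) (choiceAt L m) (choiceAt L′ m)
        ≤⟨ +-mono-≤ (segmentShare j x y (λ e∈ → sub (∈-++⁺ˡ e∈)))
                    (routeShare (suc j) L L′ (suc-injective eq)
                                (λ e∈ → sub (∈-++⁺ʳ (segmentArcs j y) e∈))) ⟩
      countIn B (segmentArcs j x) + countIn B (routeArcs (suc j) L)
        ≡⟨ sym (countIn-++ B (segmentArcs j x) (routeArcs (suc j) L)) ⟩
      countIn B (routeArcs j (x ∷ L)) ∎
      where open ≤-Reasoning

    route : Walk n k M a sV (tV k) → List Choice
    route w = Decomposition.route (decompose w)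

    route-length : ∀ w → length (route w) ≡ K + n
    route-length w = Decomposition.route-length (decompose w)

    route-valid : ∀ w → ValidRoute 0 (route w)
    route-valid w = Decomposition.valid (decompose w)

    arcs-length : ∀ w → length (arcs w) ≡ (K + n) * M
    arcs-length w = trans (cong length (Decomposition.arcs≡ (decompose w)))
      (trans (routeArcs-length 0 (route w) (≤-reflexive (route-length w))) (cong (_* M) (route-length w)))

    routeOverlap≤countIn : ∀ w w′ → routeOverlap (route w) (route w′) ≤ countIn (arcs w′) (arcs w)
    routeOverlap≤countIn w w′ =
      subst₂ _≤_ (cong (λ l → ∑[ m < l ] sharedBound m (choiceAt (route w) m) (choiceAt (route w′) m))
                       (route-length w))
                 (cong (countIn (arcs w′)) (sym (Decomposition.arcs≡ (decompose w))))
                 (routeShare 0 (route w) (route w′) (trans (route-length w) (sym (route-length w′)))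
                   (λ e∈ → subst (_ ∈_) (sym (Decomposition.arcs≡ (decompose w′))) e∈))

    ℓ≡[K+n]*M : 1 ≤ k → ℓ n k M ≡ (K + n) * M
    ℓ≡[K+n]*M 1≤k = cong (_* M) (trans (+-∸-assoc n (*-monoʳ-≤ 2 1≤k)) (+-comm n K))

    routeOverlap≤M : 1 ≤ k → ∀ w w′ → 2 * ℓ n k M ∸ 2 * M ≤ symDiffSize (arcs w) (arcs w′) →
                     routeOverlap (route w) (route w′) ≤ M
    routeOverlap≤M 1≤k w w′ far = commonPart≤
      (trans (rejected+countIn (arcs w′) (arcs w)) (arcs-length w))
      (trans (rejected+countIn (arcs w) (arcs w′)) (arcs-length w′))
      (routeOverlap≤countIn w w′)
      (subst (_≤ countIn (arcs w) (arcs w′)) (routeOverlap-sym (route w′) (route w)) (routeOverlap≤countIn w′ w))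
      (subst (λ l → 2 * l ∸ 2 * M ≤ symDiffSize (arcs w) (arcs w′)) (ℓ≡[K+n]*M 1≤k) far)

toFinPartition : ∀ {n k M} (a : Fin n → ℕ) →
  Σ (ℕ → ℕ) (λ f → (∀ i → i < n → f i < k) ×
                    (∀ q → q < k → ∑[ i < n ] (δ (f i) q * extend 0 a i) ≡ M)) →
  Σ (Fin n → Fin k) (λ f → ∀ q → partSum a f q ≡ M)
toFinPartition {n} {k} a (f , f<k , ∑≡M) =
  f′ , λ q → trans (sumFin≡∑ _ _ (term q)) (∑≡M (toℕ q) (toℕ<n q))
  where
    f′ : Fin n → Fin k
    f′ j = fromℕ< (f<k (toℕ j) (toℕ<n j))
    term : ∀ q j → (if ⌊ f′ j F.≟ q ⌋ then a j else 0) ≡ δ (f (toℕ j)) (toℕ q) * extend 0 a (toℕ j)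
    term q j = trans (𝟙-if (f′ j F.≟ q) (a j))
      (cong₂ _*_ (𝟙-cong (f′ j F.≟ q) (f (toℕ j) ≟ toℕ q)
                   (λ e → trans (sym (toℕ-fromℕ< _)) (cong toℕ e))
                   (λ e → toℕ-injective (trans (toℕ-fromℕ< _) e)))
                 (sym (extend-toℕ 0 a j)))

module PathFamily (n k M : ℕ) .{{_ : NonZero M}} (a : Fin n → ℕ)
  (a-pos : ∀ i → 0 < a i) (2≤k : 2 ≤ k) (∑a≡kM : sumFin a ≡ k * M)
  (a+2≤M : ∀ i → a i + 2 ≤ M) (2≤M : 2 ≤ M)
  (P : Fin (2 * k) → STPath n k M a)
  (far : ∀ i i′ → i F.< i′ → 2 * ℓ n k M ∸ 2 * M ≤ symDiffSize (arcs (walk (P i))) (arcs (walk (P i′))))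
  where
  open Segments n k M a
  open Bounds a-pos a+2≤M 2≤M

  routeOf : ℕ → List Choice
  routeOf = extend [] (λ p → route (walk (P p)))

  routeOf-fromℕ< : ∀ {p} (p<2k : p < 2 * k) → routeOf p ≡ route (walk (P (fromℕ< p<2k)))
  routeOf-fromℕ< = extend-fromℕ< [] (λ p → route (walk (P p)))

  blockChoice gadgetChoice : ℕ → ℕ → ℕ
  blockChoice  p j = copyIndex (choiceAt (routeOf p) j)
  gadgetChoice p i = key (choiceAt (routeOf p) (K + i))

  choiceValid : ∀ p m → p < 2 * k → m < K + n → ValidChoice m (choiceAt (routeOf p) m)
  choiceValid p m p<2k m<K+n rewrite routeOf-fromℕ< p<2k =
    choiceAt-valid 0 (route w) m (route-valid w) (subst (m <_) (sym (route-length w)) m<K+n)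
    where
      w : Walk n k M a sV (tV k)
      w = walk (P (fromℕ< p<2k))

  blockChoice<k : ∀ p j → p < 2 * k → j < K → blockChoice p j < k
  blockChoice<k p j p<2k j<K = proj₁ (choiceValid p j p<2k (<-≤-trans j<K (m≤m+n K n))) j<K

  gadgetChoice≤K : ∀ p i → p < 2 * k → i < n → gadgetChoice p i < suc K
  gadgetChoice≤K p i p<2k i<n = proj₂ (choiceValid p (K + i) p<2k (+-monoʳ-< K i<n)) (m≤m+n K i)

  agreement≤M : ∀ p q → p < q → q < 2 * k →
    M * ∑[ j < K ] δ (blockChoice p j) (blockChoice q j)
      + ∑[ i < n ] (δ (gadgetChoice p i) (gadgetChoice q i) * aℕ i) ≤ M
  agreement≤M p q p<q q<2k = subst (_≤ M) (routeOverlap-split (routeOf p) (routeOf q))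
    (subst₂ (λ L L′ → routeOverlap L L′ ≤ M) (sym (routeOf-fromℕ< p<2k)) (sym (routeOf-fromℕ< q<2k))
      (routeOverlap≤M (<⇒≤ 2≤k) (walk (P (fromℕ< p<2k))) (walk (P (fromℕ< q<2k)))
        (far (fromℕ< p<2k) (fromℕ< q<2k) (subst₂ _<_ (sym (toℕ-fromℕ< p<2k)) (sym (toℕ-fromℕ< q<2k)) p<q))))
    where
      p<2k : p < 2 * k
      p<2k = <-trans p<q q<2k

  aℕ-pos : ∀ i → i < n → 0 < aℕ i
  aℕ-pos i i<n = subst (0 <_) (sym (extend-fromℕ< 0 a i<n)) (a-pos _)

  ∑aℕ≡kM : ∑ n aℕ ≡ k * M
  ∑aℕ≡kM = trans (sym (sumFin≡∑ a aℕ (λ j → sym (extend-toℕ 0 a j)))) ∑a≡kM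

  open EqualPartition k K n M (m∸n+n≡m (*-monoʳ-≤ 2 (<⇒≤ 2≤k))) aℕ aℕ-pos ∑aℕ≡kM
         blockChoice gadgetChoice blockChoice<k gadgetChoice≤K agreement≤M

  partition : Σ (Fin n → Fin k) (λ f → ∀ q → partSum a f q ≡ M)
  partition = toFinPartition a equalPartition

lemma21 : (n k M : ℕ) (a : Fin n → ℕ) →
          (∀ i → 0 < a i) → 2 ≤ k → sumFin a ≡ k * M →
          (∀ i → a i < M) → (∀ i → a i + 2 ≤ M) →
          (P : Fin (2 * k) → STPath n k M a) →
          (∀ i i' → i F.< i' →
            2 * ℓ n k M ∸ 2 * M ≤ symDiffSize (arcs (walk (P i))) (arcs (walk (P i')))) →
          Σ (Fin n → Fin k) (λ f → ∀ q → partSum a f q ≡ M)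
lemma21 zero k M a _ 2≤k ∑a≡kM _ _ _ _ = (λ ()) , λ _ → sym M≡0
  where
    M≡0 : M ≡ 0
    M≡0 with m*n≡0⇒m≡0∨n≡0 k (sym ∑a≡kM)
    ... | inj₁ k≡0 = ⊥-elim (n≮0 (subst (2 ≤_) k≡0 2≤k))
    ... | inj₂ M≡0 = M≡0
-- The hypothesis a i < M is implied by a i + 2 ≤ M.
lemma21 (suc n) k M a a-pos 2≤k ∑a≡kM _ a+2≤M P far = partition
  where
    2≤M : 2 ≤ M
    2≤M = m+n≤o⇒n≤o (a F.zero) (a+2≤M F.zero)
    instance
      M-nonZero : NonZero M
      M-nonZero = >-nonZero (<-≤-trans z<s 2≤M)
    open PathFamily (suc n) k M a a-pos 2≤k ∑a≡kM a+2≤M 2≤M P far
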